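{- Let $n,D,h\in\mathbb{N}$ with $n-2>D\ge 2(n-1)/3$ and $n-D-1\le h\le 2D-n+1$, and let $T_{n,D,h}$ be the tree with nodes $v_0,\dots,v_{n-1}$ consisting of the path $v_0,v_1,\dots,v_D$, the path $v_{D+1},v_{D+2},\dots,v_{n-1}$, and the edge $(v_h,v_{D+1})$. Then \[|E_{fix}(T_{n,D,h})| = F_D F_{n-D-1} + F_h F_{D-h} F_{n-D-2}.\]
   Context: For a tree $T=(V,E)$, $E_{fix}(T)$ is the set of all $F\subseteq E$ with $2deg_F(v)\le deg(v)$ for every $v\in V$, where $deg_F(v)$ is the number of edges of $F$ incident to $v$ and $deg(v)$ is the degree of $v$ in $T$. $F_i$ denotes the $i$-th Fibonacci number: $F_0=0$, $F_1=1$, $F_i=F_{i-1}+F_{i-2}$. -}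

module Defs where

open import Data.Nat using (ℕ; zero; suc; _+_; _*_; _∸_; _≤_; _≟_; _≤?_)
open import Data.Bool using (Bool; true; false; _∨_; _∧_; if_then_else_)
open import Data.Product using (_×_; _,_)
open import Data.List using (List; []; _∷_; _++_; map; length; applyUpTo)
open import Relation.Nullary.Decidable using (does)

fib : ℕ → ℕ
fib zero = 0
fib (suc zero) = 1
fib (suc (suc i)) = fib (suc i) + fib i

-- An (unordered) edge between two vertices (vertices are natural numbers)
Edge : Set
Edge = ℕ × ℕ

incident : ℕ → Edge → Bool
incident v (a , b) = does (v ≟ a) ∨ does (v ≟ b)

deg : List Edge → ℕ → ℕ
deg [] v = 0
deg (e ∷ E) v = if incident v e then suc (deg E v) else deg E v

subsets : {A : Set} → List A → List (List A)
subsets [] = [] ∷ []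
subsets (x ∷ xs) = subsets xs ++ map (x ∷_) (subsets xs)

allB : {A : Set} → (A → Bool) → List A → Bool
allB p [] = true
allB p (x ∷ xs) = p x ∧ allB p xs

isFix : ℕ → List Edge → List Edge → Bool
isFix n E F = allB (λ v → does (2 * deg F v ≤? deg E v)) (applyUpTo (λ i → i) n)

count : {A : Set} → (A → Bool) → List A → ℕ
count p [] = 0
count p (x ∷ xs) = if p x then suc (count p xs) else count p xs

-- |E_fix(T)| for a graph on vertices 0..n-1 with (duplicate-free) edge list E
numFix : ℕ → List Edge → ℕ
numFix n E = count (isFix n E) (subsets E)

-- The tree T_{n,D,h} on vertices v_0..v_{n-1} (v_i represented by i):
-- path v_0 .. v_D, path v_{D+1} .. v_{n-1}, and the edge (v_h , v_{D+1}).
treeEdges : ℕ → ℕ → ℕ → List Edge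
treeEdges n D h =
  applyUpTo (λ i → (i , suc i)) D
  ++ applyUpTo (λ j → (suc D + j , suc (suc D + j))) (n ∸ D ∸ 2)
  ++ ((h , suc D) ∷ [])

-- The condition 2 deg_F(v) ≤ deg(v) says that F respects the capacity ⌊deg(v)/2⌋ at every
-- vertex. Counting capacity-respecting edge sets is recursive in the edge list: an edge is
-- either dropped, or kept and its endpoints' capacities lowered by one; and the count is
-- multiplicative over edge lists that only share vertices of capacity 0. In T_{n,D,h} the
-- capacities are 0 at the three leaves and 1 elsewhere. Splitting on the edge (v_h, v_{D+1})
-- leaves the two paths with these capacities, or, if the edge is kept, with capacity 0 at
-- v_h and v_{D+1}, which cuts the long path at v_h. A path of m edges with capacity 0 at
-- both ends and 1 inside has F_m admissible edge sets, and F_{m+1} if one end has capacity 1.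
module Submission where

open import Defs
open import Data.Nat
  using (ℕ; zero; suc; _+_; _*_; _∸_; _≤_; _<_; _≟_; _≤?_; _<?_; _<ᵇ_; _≡ᵇ_; z≤n; s≤s; ⌊_/2⌋)
open import Data.Nat.Properties
open import Algebra.Properties.CommutativeSemigroup +-commutativeSemigroup using (interchange)
open import Data.Nat.Tactic.RingSolver using (solve-∀)
open import Data.Bool using (Bool; true; false; T; _∧_; if_then_else_)
open import Data.Bool.Properties using (T-∧; T-∨; ∧-zeroʳ)
open import Data.Empty using (⊥-elim)
open import Data.Product using (_×_; _,_; proj₁; proj₂)
open import Data.Sum using (_⊎_; inj₁; inj₂)
import Data.Sum as Sum
open import Data.Unit using (tt)
open import Data.List using (List; []; _∷_; _++_; _∷ʳ_; map; applyUpTo)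
open import Data.List.Properties using (++-assoc)
open import Data.List.Membership.Propositional using (_∈_)
open import Data.List.Membership.Propositional.Properties using (∈-++⁻; ∈-map⁻)
open import Data.List.Relation.Unary.Any using (here; there)
open import Data.List.Relation.Binary.Sublist.Propositional as Sublist using (_⊆_; []; _∷_; ⊆-refl)
open import Function using (_∘_)
open import Function.Bundles using (Equivalence)
open import Relation.Nullary using (Dec; yes; no; ¬_)
open import Relation.Nullary.Decidable using (does; dec-true; dec-false)
open import Relation.Binary.PropositionalEquality
open import Relation.Binary.Definitions using (tri<; tri≈; tri>)

T-ext : ∀ {x y} → (T x → T y) → (T y → T x) → x ≡ y
T-ext {false} {false} _ _ = refl
T-ext {false} {true}  _ g = ⊥-elim (g tt)
T-ext {true}  {false} f _ = ⊥-elim (f tt)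
T-ext {true}  {true}  _ _ = refl

count-++ : ∀ {A : Set} (p : A → Bool) xs ys → count p (xs ++ ys) ≡ count p xs + count p ys
count-++ p [] ys = refl
count-++ p (x ∷ xs) ys with p x
... | true  = cong suc (count-++ p xs ys)
... | false = count-++ p xs ys

count-map : ∀ {A B : Set} (p : B → Bool) (f : A → B) xs → count p (map f xs) ≡ count (p ∘ f) xs
count-map p f [] = refl
count-map p f (x ∷ xs) with p (f x)
... | true  = cong suc (count-map p f xs)
... | false = count-map p f xs

count-cong-∈ : ∀ {A : Set} {p q : A → Bool} xs → (∀ {x} → x ∈ xs → p x ≡ q x) → count p xs ≡ count q xs
count-cong-∈ [] _ = refl
count-cong-∈ {q = q} (x ∷ xs) p≗q rewrite p≗q (here refl) with q x
... | true  = cong suc (count-cong-∈ xs (p≗q ∘ there))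
... | false = count-cong-∈ xs (p≗q ∘ there)

count-const-∧ : ∀ {A : Set} b (p : A → Bool) xs → count (λ x → b ∧ p x) xs ≡ (if b then count p xs else 0)
count-const-∧ true  p xs       = refl
count-const-∧ false p []       = refl
count-const-∧ false p (x ∷ xs) = count-const-∧ false p xs

count-subsets-∷ : ∀ {A : Set} (p : List A → Bool) x xs →
  count p (subsets (x ∷ xs)) ≡ count p (subsets xs) + count (p ∘ (x ∷_)) (subsets xs)
count-subsets-∷ p x xs =
  trans (count-++ p (subsets xs) _) (cong (count p (subsets xs) +_) (count-map p (x ∷_) (subsets xs)))

count-subsets-∷ʳ : ∀ {A : Set} (p : List A → Bool) xs x →
  count p (subsets (xs ∷ʳ x)) ≡ count p (subsets xs) + count (p ∘ (_∷ʳ x)) (subsets xs)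
count-subsets-∷ʳ p [] x = count-++ p ([] ∷ []) ((x ∷ []) ∷ [])
count-subsets-∷ʳ {A} p (y ∷ xs) x = begin
  count p (subsets (y ∷ xs ∷ʳ x))
    ≡⟨ count-subsets-∷ p y (xs ∷ʳ x) ⟩
  count p (subsets (xs ∷ʳ x)) + count (p ∘ (y ∷_)) (subsets (xs ∷ʳ x))
    ≡⟨ cong₂ _+_ (count-subsets-∷ʳ p xs x) (count-subsets-∷ʳ (p ∘ (y ∷_)) xs x) ⟩
  (count p S + count (p ∘ (_∷ʳ x)) S) + (count (p ∘ (y ∷_)) S + count (p ∘ (y ∷_) ∘ (_∷ʳ x)) S)
    ≡⟨ interchange (count p S) _ (count (p ∘ (y ∷_)) S) _ ⟩
  (count p S + count (p ∘ (y ∷_)) S) + (count (p ∘ (_∷ʳ x)) S + count (p ∘ (y ∷_) ∘ (_∷ʳ x)) S)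
    ≡⟨ sym (cong₂ _+_ (count-subsets-∷ p y xs) (count-subsets-∷ (p ∘ (_∷ʳ x)) y xs)) ⟩
  count p (subsets (y ∷ xs)) + count (p ∘ (_∷ʳ x)) (subsets (y ∷ xs)) ∎
  where
  open ≡-Reasoning
  S : List (List A)
  S = subsets xs

∈-subsets⇒⊆ : ∀ {A : Set} {ys : List A} xs → ys ∈ subsets xs → ys ⊆ xs
∈-subsets⇒⊆ [] (here refl) = []
∈-subsets⇒⊆ (x ∷ xs) ys∈ with ∈-++⁻ (subsets xs) ys∈
... | inj₁ ys∈′ = x Sublist.∷ʳ ∈-subsets⇒⊆ xs ys∈′
... | inj₂ ys∈′ with ∈-map⁻ (x ∷_) ys∈′
...   | zs , zs∈ , refl = refl ∷ ∈-subsets⇒⊆ xs zs∈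

incident⇒endpoint : ∀ {v a b} → T (incident v (a , b)) → v ≡ a ⊎ v ≡ b
incident⇒endpoint {v} {a} {b} = Sum.map (≡ᵇ⇒≡ v a) (≡ᵇ⇒≡ v b) ∘ Equivalence.to (T-∨ {v ≡ᵇ a})

incident-left : ∀ a b → T (incident a (a , b))
incident-left a b = Equivalence.from (T-∨ {a ≡ᵇ a}) (inj₁ (≡⇒≡ᵇ a a refl))

incident-right : ∀ a b → T (incident b (a , b))
incident-right a b = Equivalence.from (T-∨ {b ≡ᵇ a}) (inj₂ (≡⇒≡ᵇ b b refl))

incident-≢ : ∀ {v a b} → v ≢ a → v ≢ b → incident v (a , b) ≡ false
incident-≢ {v} {a} {b} v≢a v≢b rewrite dec-false (v ≟ a) v≢a | dec-false (v ≟ b) v≢b = refl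

deg-++ : ∀ F G v → deg (F ++ G) v ≡ deg F v + deg G v
deg-++ [] G v = refl
deg-++ (e ∷ F) G v with incident v e
... | true  = cong suc (deg-++ F G v)
... | false = deg-++ F G v

deg-∷ʳ : ∀ F e v → deg (F ∷ʳ e) v ≡ deg (e ∷ F) v
deg-∷ʳ F e v = trans (deg-++ F (e ∷ []) v) (trans (+-comm (deg F v) _) (sym (deg-++ (e ∷ []) F v)))

deg-mono : ∀ {F E} → F ⊆ E → ∀ v → deg F v ≤ deg E v
deg-mono [] v = z≤n
deg-mono (e Sublist.∷ʳ F⊆E) v with incident v e
... | true  = m≤n⇒m≤1+n (deg-mono F⊆E v)
... | false = deg-mono F⊆E v
deg-mono (_∷_ {x = e} refl F⊆E) v with incident v e
... | true  = s≤s (deg-mono F⊆E v)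
... | false = deg-mono F⊆E v

deg-∷-incident : ∀ e E v → T (incident v e) → deg (e ∷ E) v ≡ suc (deg E v)
deg-∷-incident e E v inc with incident v e
... | true = refl

deg-∷-away : ∀ e E v → incident v e ≡ false → deg (e ∷ E) v ≡ deg E v
deg-∷-away e E v away rewrite away = refl

deg-∷-pos : ∀ e E v → 0 < deg E v → 0 < deg (e ∷ E) v
deg-∷-pos e E v pos = ≤-trans pos (deg-mono {E} {e ∷ E} (e Sublist.∷ʳ ⊆-refl) v)

incident⇒deg-pos : ∀ e E v → T (incident v e) → 0 < deg (e ∷ E) v
incident⇒deg-pos e E v inc with incident v e
... | true = s≤s z≤n

Capacity : Set
Capacity = ℕ → ℕ

usable : Capacity → Edge → Bool
usable c (a , b) = (0 <ᵇ c a) ∧ (0 <ᵇ c b)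

consume : Capacity → Edge → Capacity
consume c e v = if incident v e then c v ∸ 1 else c v

consume-incident : ∀ c e v → T (incident v e) → consume c e v ≡ c v ∸ 1
consume-incident c e v inc with incident v e
... | true = refl

consume-away : ∀ c e v → incident v e ≡ false → consume c e v ≡ c v
consume-away c e v away rewrite away = refl

consume-0 : ∀ c e v → c v ≡ 0 → consume c e v ≡ 0
consume-0 c e v cv≡0 with incident v e
... | true  = cong (_∸ 1) cv≡0
... | false = cv≡0

fits : Capacity → List Edge → Bool
fits c []      = true
fits c (e ∷ F) = usable c e ∧ fits (consume c e) F

usable⇒endpoint-pos : ∀ c e {v} → T (usable c e) → T (incident v e) → 0 < c v
usable⇒endpoint-pos c (a , b) {v} u inc with Equivalence.to (T-∧ {0 <ᵇ c a}) u | incident⇒endpoint {v} {a} {b} inc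
... | ua , _ | inj₁ refl = <ᵇ⇒< 0 (c a) ua
... | _ , ub | inj₂ refl = <ᵇ⇒< 0 (c b) ub

endpoint-pos⇒usable : ∀ c e → (∀ v → T (incident v e) → 0 < c v) → T (usable c e)
endpoint-pos⇒usable c (a , b) pos =
  Equivalence.from (T-∧ {0 <ᵇ c a}) (<⇒<ᵇ (pos a (incident-left a b)) , <⇒<ᵇ (pos b (incident-right a b)))

deg-∷-≤ : ∀ c e F → T (usable c e) → (∀ v → deg F v ≤ consume c e v) → ∀ v → deg (e ∷ F) v ≤ c v
deg-∷-≤ c e F u F≤ v with incident v e in inc | F≤ v
... | false | d≤ = d≤
... | true  | d≤ = subst (_≤ c v) (+-comm (deg F v) 1)
                     (m≤o∸n⇒m+n≤o (deg F v) (usable⇒endpoint-pos c e u (subst T (sym inc) tt)) d≤)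

deg-∷-≤⁻ : ∀ c e F → (∀ v → deg (e ∷ F) v ≤ c v) →
  T (usable c e) × (∀ v → deg F v ≤ consume c e v)
deg-∷-≤⁻ c e F ≤c = endpoint-pos⇒usable c e pos , F≤
  where
  pos : ∀ v → T (incident v e) → 0 < c v
  pos v inc with incident v e | ≤c v
  pos v () | false | _
  pos v _  | true  | d≤ = ≤-trans (s≤s z≤n) d≤
  F≤ : ∀ v → deg F v ≤ consume c e v
  F≤ v with incident v e | ≤c v
  ... | false | d≤ = d≤
  ... | true  | d≤ = ∸-monoˡ-≤ 1 d≤

fits-sound : ∀ c F → T (fits c F) → ∀ v → deg F v ≤ c v
fits-sound c [] _ v = z≤n
fits-sound c (e ∷ F) ok with Equivalence.to T-∧ ok
... | u , ok′ = deg-∷-≤ c e F u (fits-sound (consume c e) F ok′)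

fits-complete : ∀ c F → (∀ v → deg F v ≤ c v) → T (fits c F)
fits-complete c [] _ = tt
fits-complete c (e ∷ F) ≤c with deg-∷-≤⁻ c e F ≤c
... | u , F≤ = Equivalence.from T-∧ (u , fits-complete (consume c e) F F≤)

fits-deg-cong : ∀ c {F G} → (∀ v → deg F v ≡ deg G v) → fits c F ≡ fits c G
fits-deg-cong c {F} {G} F≗G = T-ext
  (λ ok → fits-complete c G (λ v → subst (_≤ c v) (F≗G v) (fits-sound c F ok v)))
  (λ ok → fits-complete c F (λ v → subst (_≤ c v) (sym (F≗G v)) (fits-sound c G ok v)))

2*m≤n⇒m≤⌊n/2⌋ : ∀ m n → 2 * m ≤ n → m ≤ ⌊ n /2⌋
2*m≤n⇒m≤⌊n/2⌋ m n 2m≤n =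
  subst (_≤ ⌊ n /2⌋) (sym (n≡⌊n+n/2⌋ m)) (⌊n/2⌋-mono (subst (_≤ n) (cong (m +_) (+-identityʳ m)) 2m≤n))

m≤⌊n/2⌋⇒2*m≤n : ∀ m n → m ≤ ⌊ n /2⌋ → 2 * m ≤ n
m≤⌊n/2⌋⇒2*m≤n m n m≤ = begin
  2 * m                   ≡⟨ cong (m +_) (+-identityʳ m) ⟩
  m + m                   ≤⟨ +-mono-≤ m≤ (≤-trans m≤ (⌊n/2⌋≤⌈n/2⌉ n)) ⟩
  ⌊ n /2⌋ + ⌊ suc n /2⌋   ≡⟨ ⌊n/2⌋+⌈n/2⌉≡n n ⟩
  n                       ∎
  where open ≤-Reasoning

allB-applyUpTo⁻ : ∀ (p : ℕ → Bool) f n → T (allB p (applyUpTo f n)) → ∀ i → i < n → T (p (f i))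
allB-applyUpTo⁻ p f (suc n) all zero    _          = proj₁ (Equivalence.to T-∧ all)
allB-applyUpTo⁻ p f (suc n) all (suc i) (s≤s i<n) =
  allB-applyUpTo⁻ p (f ∘ suc) n (proj₂ (Equivalence.to T-∧ all)) i i<n

allB-applyUpTo⁺ : ∀ (p : ℕ → Bool) f n → (∀ i → i < n → T (p (f i))) → T (allB p (applyUpTo f n))
allB-applyUpTo⁺ p f zero    _   = tt
allB-applyUpTo⁺ p f (suc n) all =
  Equivalence.from T-∧ (all 0 (s≤s z≤n) , allB-applyUpTo⁺ p (f ∘ suc) n (λ i i<n → all (suc i) (s≤s i<n)))

-- isFix checks only the vertices below n; beyond them the capacity deg E v rules out no sublist of E.
fixCapacity : ℕ → List Edge → Capacity
fixCapacity n E v = if does (v <? n) then ⌊ deg E v /2⌋ else deg E v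

fixCapacity-< : ∀ n E {v} → v < n → fixCapacity n E v ≡ ⌊ deg E v /2⌋
fixCapacity-< n E {v} v<n rewrite dec-true (v <? n) v<n = refl

fixCapacity-≮ : ∀ n E {v} → ¬ v < n → fixCapacity n E v ≡ deg E v
fixCapacity-≮ n E {v} v≮n rewrite dec-false (v <? n) v≮n = refl

isFix≡fits : ∀ n E F → F ⊆ E → isFix n E F ≡ fits (fixCapacity n E) F
isFix≡fits n E F F⊆E = T-ext (fits-complete _ F ∘ bounded) (checked ∘ fits-sound _ F)
  where
  fixed : ℕ → Bool
  fixed v = does (2 * deg F v ≤? deg E v)
  bounded : T (isFix n E F) → ∀ v → deg F v ≤ fixCapacity n E v
  bounded fix v with v <? n
  ... | yes v<n = subst (deg F v ≤_) (sym (fixCapacity-< n E v<n))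
                    (2*m≤n⇒m≤⌊n/2⌋ _ _ (≤ᵇ⇒≤ _ _ (allB-applyUpTo⁻ fixed (λ i → i) n fix v v<n)))
  ... | no  v≮n = subst (deg F v ≤_) (sym (fixCapacity-≮ n E v≮n)) (deg-mono F⊆E v)
  checked : (∀ v → deg F v ≤ fixCapacity n E v) → T (isFix n E F)
  checked ≤cap = allB-applyUpTo⁺ fixed (λ i → i) n (λ v v<n →
    ≤⇒≤ᵇ (m≤⌊n/2⌋⇒2*m≤n _ _ (subst (deg F v ≤_) (fixCapacity-< n E v<n) (≤cap v))))

countFit : List Edge → Capacity → ℕ
countFit E c = count (fits c) (subsets E)

countFitWith : Edge → List Edge → Capacity → ℕ
countFitWith e E c = if usable c e then countFit E (consume c e) else 0

numFix≡countFit : ∀ n E → numFix n E ≡ countFit E (fixCapacity n E)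
numFix≡countFit n E = count-cong-∈ (subsets E) (λ {F} F∈ → isFix≡fits n E F (∈-subsets⇒⊆ E F∈))

countFit-∷ : ∀ e E c → countFit (e ∷ E) c ≡ countFit E c + countFitWith e E c
countFit-∷ e E c = trans (count-subsets-∷ (fits c) e E)
  (cong (countFit E c +_) (count-const-∧ (usable c e) (fits (consume c e)) (subsets E)))

countFit-∷ʳ : ∀ E e c → countFit (E ∷ʳ e) c ≡ countFit E c + countFitWith e E c
countFit-∷ʳ E e c = trans (count-subsets-∷ʳ (fits c) E e) (cong (countFit E c +_) (begin
  count (fits c ∘ (_∷ʳ e)) (subsets E)
    ≡⟨ count-cong-∈ (subsets E) (λ {F} _ → fits-deg-cong c {F ∷ʳ e} {e ∷ F} (deg-∷ʳ F e)) ⟩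
  count (fits c ∘ (e ∷_)) (subsets E)
    ≡⟨ count-const-∧ (usable c e) (fits (consume c e)) (subsets E) ⟩
  countFitWith e E c ∎))
  where open ≡-Reasoning

countFitWith-blocked : ∀ e E c → usable c e ≡ false → countFitWith e E c ≡ 0
countFitWith-blocked e E c blocked rewrite blocked = refl

countFitWith-open : ∀ e E c → T (usable c e) → countFitWith e E c ≡ countFit E (consume c e)
countFitWith-open e E c u with usable c e
... | true = refl

usable-local : ∀ c c′ e → (∀ v → T (incident v e) → c v ≡ c′ v) → usable c e ≡ usable c′ e
usable-local c c′ (a , b) agree rewrite agree a (incident-left a b) | agree b (incident-right a b) = refl

countFit-local : ∀ E {c c′} → (∀ v → 0 < deg E v → c v ≡ c′ v) → countFit E c ≡ countFit E c′
countFit-local [] agree = refl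
countFit-local (e ∷ E) {c} {c′} agree = begin
  countFit (e ∷ E) c                   ≡⟨ countFit-∷ e E c ⟩
  countFit E c + countFitWith e E c    ≡⟨ cong₂ _+_ (countFit-local E (λ v → agree v ∘ deg-∷-pos e E v)) with-e ⟩
  countFit E c′ + countFitWith e E c′  ≡⟨ countFit-∷ e E c′ ⟨
  countFit (e ∷ E) c′                  ∎
  where
  open ≡-Reasoning
  with-e : countFitWith e E c ≡ countFitWith e E c′
  with-e rewrite usable-local c c′ e (λ v → agree v ∘ incident⇒deg-pos e E v) with usable c′ e
  ... | true  = countFit-local E (λ v pos → cong (λ x → if incident v e then x ∸ 1 else x)
                                                 (agree v (deg-∷-pos e E v pos)))
  ... | false = refl

countFit-++ : ∀ L {M c} → (∀ v → 0 < deg L v → 0 < deg M v → c v ≡ 0) →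
  countFit (L ++ M) c ≡ countFit L c * countFit M c
countFit-++ [] {M} _ = sym (+-identityʳ (countFit M _))
countFit-++ (e ∷ L) {M} {c} shared = begin
  countFit (e ∷ L ++ M) c
    ≡⟨ countFit-∷ e (L ++ M) c ⟩
  countFit (L ++ M) c + countFitWith e (L ++ M) c
    ≡⟨ cong₂ _+_ (countFit-++ L (λ v → shared v ∘ deg-∷-pos e L v)) with-e ⟩
  countFit L c * countFit M c + countFitWith e L c * countFit M c
    ≡⟨ *-distribʳ-+ (countFit M c) (countFit L c) (countFitWith e L c) ⟨
  (countFit L c + countFitWith e L c) * countFit M c
    ≡⟨ cong (_* countFit M c) (countFit-∷ e L c) ⟨
  countFit (e ∷ L) c * countFit M c ∎
  where
  open ≡-Reasoning
  consume-on-M : ∀ v → 0 < deg M v → consume c e v ≡ c v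
  consume-on-M v pos with incident v e in inc
  ... | true  = trans (cong (_∸ 1) c0) (sym c0)
    where
    c0 : c v ≡ 0
    c0 = shared v (incident⇒deg-pos e L v (subst T (sym inc) tt)) pos
  ... | false = refl
  with-e : countFitWith e (L ++ M) c ≡ countFitWith e L c * countFit M c
  with-e with usable c e
  ... | true  = trans (countFit-++ L (λ v pL pM → consume-0 c e v (shared v (deg-∷-pos e L v pL) pM)))
                      (cong (countFit L (consume c e) *_) (countFit-local M consume-on-M))
  ... | false = refl

1+m<m+[2+n] : ∀ m n → suc m < m + suc (suc n)
1+m<m+[2+n] m n = subst (suc m <_) (sym (+-suc m (suc n))) (s≤s (m<m+n m (s≤s z≤n)))

2+m+n∸m≡2+n : ∀ m n → suc (suc (m + n)) ∸ m ≡ suc (suc n)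
2+m+n∸m≡2+n m n = trans (+-∸-assoc 2 (m≤m+n m n)) (cong (2 +_) (m+n∸m≡n m n))

path : ℕ → ℕ → List Edge
path a zero    = []
path a (suc m) = (a , suc a) ∷ path (suc a) m

applyUpTo≡path : ∀ m a (f : ℕ → Edge) → (∀ i → f i ≡ (a + i , suc (a + i))) → applyUpTo f m ≡ path a m
applyUpTo≡path zero    a f f≗ = refl
applyUpTo≡path (suc m) a f f≗ = cong₂ _∷_
  (trans (f≗ 0) (cong (λ x → (x , suc x)) (+-identityʳ a)))
  (applyUpTo≡path m (suc a) (f ∘ suc) (λ i → trans (f≗ (suc i)) (cong (λ x → (x , suc x)) (+-suc a i))))

path-++ : ∀ m k a → path a (m + k) ≡ path a m ++ path (a + m) k
path-++ zero    k a rewrite +-identityʳ a = refl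
path-++ (suc m) k a rewrite +-suc a m = cong ((a , suc a) ∷_) (path-++ m k (suc a))

deg-path-below : ∀ m {a v} → v < a → deg (path a m) v ≡ 0
deg-path-below zero    v<a = refl
deg-path-below (suc m) {a} {v} v<a =
  trans (deg-∷-away (a , suc a) (path (suc a) m) v (incident-≢ (<⇒≢ v<a) (<⇒≢ (m<n⇒m<1+n v<a))))
        (deg-path-below m (m<n⇒m<1+n v<a))

deg-path-above : ∀ m {a v} → a + m < v → deg (path a m) v ≡ 0
deg-path-above zero    end<v = refl
deg-path-above (suc m) {a} {v} end<v = trans
  (deg-∷-away (a , suc a) (path (suc a) m) v (incident-≢ (>⇒≢ (≤-<-trans (m≤m+n a (suc m)) end<v))
                          (>⇒≢ (≤-<-trans (subst (suc a ≤_) (sym (+-suc a m)) (s≤s (m≤m+n a m))) end<v))))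
  (deg-path-above m (subst (_< v) (+-suc a m) end<v))

deg-path-first : ∀ m a → deg (path a (suc m)) a ≡ 1
deg-path-first m a = trans (deg-∷-incident (a , suc a) (path (suc a) m) a (incident-left a (suc a)))
                           (cong suc (deg-path-below m (n<1+n a)))

deg-path-last : ∀ m a → deg (path a (suc m)) (a + suc m) ≡ 1
deg-path-last zero a rewrite +-comm a 1 = deg-∷-incident (a , suc a) [] (suc a) (incident-right a (suc a))
deg-path-last (suc m) a = trans
  (deg-∷-away (a , suc a) (path (suc a) (suc m)) (a + suc (suc m))
    (incident-≢ (>⇒≢ (m<m+n a (s≤s z≤n))) (>⇒≢ (1+m<m+[2+n] a m))))
  (subst (λ x → deg (path (suc a) (suc m)) x ≡ 1) (sym (+-suc a (suc m))) (deg-path-last m (suc a)))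

deg-path-inner : ∀ m {a v} → a < v → v < a + m → deg (path a m) v ≡ 2
deg-path-inner zero    {a} {v} a<v v<a+0 = ⊥-elim (<-asym a<v (subst (v <_) (+-identityʳ a) v<a+0))
deg-path-inner (suc m) {a} {v} a<v v<end = by-cases (v ≟ suc a)
  where
  by-cases : Dec (v ≡ suc a) → deg (path a (suc m)) v ≡ 2
  by-cases (yes refl) = trans (deg-∷-incident (a , suc a) (path (suc a) m) (suc a) (incident-right a (suc a)))
                              (cong suc (second-degree m v<end))
    where
    second-degree : ∀ m → suc a < a + suc m → deg (path (suc a) m) (suc a) ≡ 1
    second-degree zero    1+a<a+1 = ⊥-elim (<-irrefl (sym (+-comm a 1)) 1+a<a+1)
    second-degree (suc m) _       = deg-path-first m (suc a)
  by-cases (no v≢1+a) =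
    trans (deg-∷-away (a , suc a) (path (suc a) m) v (incident-≢ (>⇒≢ a<v) v≢1+a))
          (deg-path-inner m (≤∧≢⇒< a<v (v≢1+a ∘ sym)) (subst (v <_) (+-suc a m) v<end))

OnesBetween : Capacity → ℕ → ℕ → Set
OnesBetween c a b = ∀ v → a < v → v < b → c v ≡ 1

usable-blockedˡ : ∀ c a b → c a ≡ 0 → usable c (a , b) ≡ false
usable-blockedˡ c a b ca≡0 rewrite ca≡0 = refl

usable-blockedʳ : ∀ c a b → c b ≡ 0 → usable c (a , b) ≡ false
usable-blockedʳ c a b cb≡0 rewrite cb≡0 = ∧-zeroʳ (0 <ᵇ c a)

usable-ones : ∀ c a b → c a ≡ 1 → c b ≡ 1 → T (usable c (a , b))
usable-ones c a b ca≡1 cb≡1 rewrite ca≡1 | cb≡1 = tt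

countFit-∷-blocked : ∀ e E c → usable c e ≡ false → countFit (e ∷ E) c ≡ countFit E c
countFit-∷-blocked e E c blocked =
  trans (countFit-∷ e E c) (trans (cong (countFit E c +_) (countFitWith-blocked e E c blocked)) (+-identityʳ _))

OnesBetween-tail : ∀ m a c → OnesBetween c a (a + suc (suc m)) → OnesBetween c (suc a) (suc a + suc m)
OnesBetween-tail m a c ones v a+1<v v<end =
  ones v (<-trans (n<1+n a) a+1<v) (subst (v <_) (sym (+-suc a (suc m))) v<end)

countFit-path-closed : ∀ m a c → OnesBetween c a (a + suc m) → c a ≡ 0 → c (a + suc m) ≡ 0 →
  countFit (path a (suc m)) c ≡ fib (suc m)
countFit-path-open : ∀ m a c → OnesBetween c a (a + suc m) → c a ≡ 1 → c (a + suc m) ≡ 0 →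
  countFit (path a (suc m)) c ≡ fib (suc (suc m))

countFit-path-closed zero a c _ ca≡0 _ =
  countFit-∷-blocked (a , suc a) [] c (usable-blockedˡ c a (suc a) ca≡0)
countFit-path-closed (suc m) a c ones ca≡0 end≡0 = trans
  (countFit-∷-blocked (a , suc a) (path (suc a) (suc m)) c (usable-blockedˡ c a (suc a) ca≡0))
  (countFit-path-open m (suc a) c (OnesBetween-tail m a c ones)
    (ones (suc a) (n<1+n a) (1+m<m+[2+n] a m)) (subst (λ x → c x ≡ 0) (+-suc a (suc m)) end≡0))

countFit-path-open zero a c _ _ end≡0 =
  countFit-∷-blocked (a , suc a) [] c (usable-blockedʳ c a (suc a) (subst (λ x → c x ≡ 0) (+-comm a 1) end≡0))
countFit-path-open (suc m) a c ones ca≡1 end≡0 = begin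
  countFit (e ∷ rest) c                          ≡⟨ countFit-∷ e rest c ⟩
  countFit rest c + countFitWith e rest c        ≡⟨ cong (countFit rest c +_) (countFitWith-open e rest c e-usable) ⟩
  countFit rest c + countFit rest (consume c e)  ≡⟨ cong₂ _+_ without-e with-e ⟩
  fib (suc (suc m)) + fib (suc m)                ∎
  where
  open ≡-Reasoning
  e : Edge
  e = (a , suc a)
  rest : List Edge
  rest = path (suc a) (suc m)
  ones′ : OnesBetween c (suc a) (suc a + suc m)
  ones′ = OnesBetween-tail m a c ones
  c[1+a]≡1 : c (suc a) ≡ 1
  c[1+a]≡1 = ones (suc a) (n<1+n a) (1+m<m+[2+n] a m)
  end′≡0 : c (suc a + suc m) ≡ 0
  end′≡0 = subst (λ x → c x ≡ 0) (+-suc a (suc m)) end≡0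
  e-usable : T (usable c e)
  e-usable = usable-ones c a (suc a) ca≡1 c[1+a]≡1
  beyond-e : ∀ v → suc a < v → consume c e v ≡ c v
  beyond-e v a+1<v = consume-away c e v (incident-≢ (>⇒≢ (<-trans (n<1+n a) a+1<v)) (>⇒≢ a+1<v))
  without-e : countFit rest c ≡ fib (suc (suc m))
  without-e = countFit-path-open m (suc a) c ones′ c[1+a]≡1 end′≡0
  with-e : countFit rest (consume c e) ≡ fib (suc m)
  with-e = countFit-path-closed m (suc a) (consume c e)
    (λ v a+1<v v<end → trans (beyond-e v a+1<v) (ones′ v a+1<v v<end))
    (trans (consume-incident c e (suc a) (incident-right a (suc a))) (cong (_∸ 1) c[1+a]≡1))
    (trans (beyond-e _ (s≤s (m<m+n a (s≤s z≤n)))) end′≡0)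

module _ (h′ b k : ℕ) where
  private
    h D n : ℕ
    h = suc h′
    D = h + suc b
    n = suc (suc (D + suc k))
    e : Edge
    e = (h , suc D)
    spine branch E : List Edge
    spine  = path 0 D
    branch = path (suc D) (suc k)
    E = (spine ++ branch) ∷ʳ e
    c c′ : Capacity
    c  = fixCapacity n E
    c′ = consume c e

    0<h : 0 < h
    0<h = s≤s z≤n
    h<D : h < D
    h<D = m<m+n h (s≤s z≤n)
    ≤D⇒<n : ∀ {v} → v ≤ D → v < n
    ≤D⇒<n v≤D = ≤-trans (s≤s v≤D) (s≤s (≤-trans (m≤m+n D (suc k)) (n≤1+n _)))

    treeEdges≡E : treeEdges n D h ≡ E
    treeEdges≡E = begin
      treeEdges n D h
        ≡⟨ cong₂ (λ P Q → P ++ Q ++ e ∷ []) (applyUpTo≡path D 0 _ (λ _ → refl))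
                 (trans (cong (applyUpTo _) (cong (_∸ 2) (2+m+n∸m≡2+n D (suc k))))
                        (applyUpTo≡path (suc k) (suc D) _ (λ _ → refl))) ⟩
      spine ++ branch ++ e ∷ []   ≡⟨ ++-assoc spine branch (e ∷ []) ⟨
      E                           ∎
      where open ≡-Reasoning

    capacity : ∀ {v x y z} → v < n → deg spine v ≡ x → deg branch v ≡ y → deg (e ∷ []) v ≡ z →
      c v ≡ ⌊ x + y + z /2⌋
    capacity {v} v<n refl refl refl = trans (fixCapacity-< n E v<n)
      (cong ⌊_/2⌋ (trans (deg-++ (spine ++ branch) (e ∷ []) v) (cong (_+ deg (e ∷ []) v) (deg-++ spine branch v))))

    off-e : ∀ {v} → v ≢ h → v ≢ suc D → deg (e ∷ []) v ≡ 0
    off-e {v} v≢h v≢1+D = deg-∷-away e [] v (incident-≢ v≢h v≢1+D)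
    spine-only : ∀ {v} → v ≤ D → deg branch v ≡ 0
    spine-only v≤D = deg-path-below (suc k) (s≤s v≤D)
    branch-only : ∀ {v} → D < v → deg spine v ≡ 0
    branch-only D<v = deg-path-above D D<v

    c-first : c 0 ≡ 0
    c-first = capacity (s≤s z≤n) (deg-path-first (h′ + suc b) 0) (spine-only z≤n) (off-e {0} (λ ()) (λ ()))

    c-spine : OnesBetween c 0 D
    c-spine v 0<v v<D with v ≟ h
    ... | yes refl = capacity (≤D⇒<n (<⇒≤ v<D)) (deg-path-inner D 0<v v<D) (spine-only (<⇒≤ v<D))
                       (deg-∷-incident e [] h (incident-left h (suc D)))
    ... | no v≢h   = capacity (≤D⇒<n (<⇒≤ v<D)) (deg-path-inner D 0<v v<D) (spine-only (<⇒≤ v<D))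
                       (off-e v≢h (<⇒≢ (m<n⇒m<1+n v<D)))

    c-D : c D ≡ 0
    c-D = capacity (≤D⇒<n ≤-refl) (deg-path-last (h′ + suc b) 0) (spine-only ≤-refl)
      (off-e (>⇒≢ h<D) (<⇒≢ (n<1+n D)))

    c-fork : c (suc D) ≡ 1
    c-fork = capacity (s≤s (s≤s (m≤m+n D (suc k)))) (branch-only (n<1+n D)) (deg-path-first k (suc D))
               (deg-∷-incident e [] (suc D) (incident-right h (suc D)))

    c-branch : OnesBetween c (suc D) (suc D + suc k)
    c-branch v 1+D<v v<end = capacity (<-trans v<end (n<1+n _)) (branch-only (<-trans (n<1+n D) 1+D<v))
      (deg-path-inner (suc k) 1+D<v v<end) (off-e (>⇒≢ (<-trans h<D (<-trans (n<1+n D) 1+D<v))) (>⇒≢ 1+D<v))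

    c-leaf : c (suc D + suc k) ≡ 0
    c-leaf = capacity (n<1+n _) (branch-only (s≤s (m≤m+n D (suc k)))) (deg-path-last k (suc D))
      (off-e (>⇒≢ (<-trans h<D (s≤s (m≤m+n D (suc k))))) (>⇒≢ (m<m+n (suc D) (s≤s z≤n))))

    c′-away : ∀ {v} → v ≢ h → v ≢ suc D → c′ v ≡ c v
    c′-away {v} v≢h v≢1+D = consume-away c e v (incident-≢ v≢h v≢1+D)
    c′-h : c′ h ≡ 0
    c′-h = trans (consume-incident c e h (incident-left h (suc D))) (cong (_∸ 1) (c-spine h 0<h h<D))
    c′-fork : c′ (suc D) ≡ 0
    c′-fork = trans (consume-incident c e (suc D) (incident-right h (suc D))) (cong (_∸ 1) c-fork)

    spine-count : countFit spine c ≡ fib D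
    spine-count = countFit-path-closed (h′ + suc b) 0 c c-spine c-first c-D

    branch-count : countFit branch c ≡ fib (suc (suc k))
    branch-count = countFit-path-open k (suc D) c c-branch c-fork c-leaf

    spine-count′ : countFit spine c′ ≡ fib h * fib (suc b)
    spine-count′ = begin
      countFit spine c′                                     ≡⟨ cong (λ P → countFit P c′) (path-++ h _ 0) ⟩
      countFit (path 0 h ++ path h (suc b)) c′              ≡⟨ countFit-++ (path 0 h) meet-at-h ⟩
      countFit (path 0 h) c′ * countFit (path h (suc b)) c′ ≡⟨ cong₂ _*_ left right ⟩
      fib h * fib (suc b)                                   ∎
      where
      open ≡-Reasoning
      meet-at-h : ∀ v → 0 < deg (path 0 h) v → 0 < deg (path h (suc b)) v → c′ v ≡ 0
      meet-at-h v inL inR with <-cmp v h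
      ... | tri< v<h _ _ = ⊥-elim (>⇒≢ inR (deg-path-below (suc b) v<h))
      ... | tri≈ _ refl _ = c′-h
      ... | tri> _ _ h<v = ⊥-elim (>⇒≢ inL (deg-path-above h h<v))
      left : countFit (path 0 h) c′ ≡ fib h
      left = countFit-path-closed h′ 0 c′
        (λ v 0<v v<h → trans (c′-away (<⇒≢ v<h) (<⇒≢ (<-trans v<h (<-trans h<D (n<1+n D)))))
                             (c-spine v 0<v (<-trans v<h h<D)))
        (trans (c′-away {0} (λ ()) (λ ())) c-first) c′-h
      right : countFit (path h (suc b)) c′ ≡ fib (suc b)
      right = countFit-path-closed b h c′
        (λ v h<v v<D → trans (c′-away (>⇒≢ h<v) (<⇒≢ (m<n⇒m<1+n v<D))) (c-spine v (<-trans 0<h h<v) v<D))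
        c′-h (trans (c′-away (>⇒≢ h<D) (<⇒≢ (n<1+n D))) c-D)

    branch-count′ : countFit branch c′ ≡ fib (suc k)
    branch-count′ = countFit-path-closed k (suc D) c′
      (λ v 1+D<v v<end → trans (c′-away (>⇒≢ (<-trans h<D (<-trans (n<1+n D) 1+D<v))) (>⇒≢ 1+D<v))
                               (c-branch v 1+D<v v<end))
      c′-fork
      (trans (c′-away (>⇒≢ (<-trans h<D (s≤s (m≤m+n D (suc k))))) (>⇒≢ (m<m+n (suc D) (s≤s z≤n)))) c-leaf)

    e-usable : T (usable c e)
    e-usable = usable-ones c h (suc D) (c-spine h 0<h h<D) c-fork

    spine-branch-disjoint : ∀ (d : Capacity) v → 0 < deg spine v → 0 < deg branch v → d v ≡ 0
    spine-branch-disjoint d v inS inB with v ≤? D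
    ... | yes v≤D = ⊥-elim (>⇒≢ inB (spine-only v≤D))
    ... | no  v≰D = ⊥-elim (>⇒≢ inS (branch-only (≰⇒> v≰D)))

  numFix-broom : numFix n (treeEdges n D h) ≡ fib D * fib (suc (suc k)) + fib h * fib (suc b) * fib (suc k)
  numFix-broom = begin
    numFix n (treeEdges n D h)
      ≡⟨ trans (cong (numFix n) treeEdges≡E) (numFix≡countFit n E) ⟩
    countFit ((spine ++ branch) ∷ʳ e) c
      ≡⟨ countFit-∷ʳ (spine ++ branch) e c ⟩
    countFit (spine ++ branch) c + countFitWith e (spine ++ branch) c
      ≡⟨ cong (countFit (spine ++ branch) c +_) (countFitWith-open e (spine ++ branch) c e-usable) ⟩
    countFit (spine ++ branch) c + countFit (spine ++ branch) c′
      ≡⟨ cong₂ _+_ (countFit-++ spine (spine-branch-disjoint c)) (countFit-++ spine (spine-branch-disjoint c′)) ⟩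
    countFit spine c * countFit branch c + countFit spine c′ * countFit branch c′
      ≡⟨ cong₂ _+_ (cong₂ _*_ spine-count branch-count) (cong₂ _*_ spine-count′ branch-count′) ⟩
    fib D * fib (suc (suc k)) + fib h * fib (suc b) * fib (suc k) ∎
    where open ≡-Reasoning

branch-point-inside : ∀ D h k → 0 < h → h ≤ 2 * D + 1 ∸ suc (suc (D + suc k)) → h < D
branch-point-inside D h k 0<h h≤ = m+n≤o⇒m≤o (suc h) (≤-pred (+-cancelˡ-≤ D _ _ bound))
  where
  n<2D+1 : suc (suc (D + suc k)) < 2 * D + 1
  n<2D+1 = m∸n≢0⇒n<m (m<n⇒n≢0 (≤-trans 0<h h≤))
  reassoc : ∀ D h k → h + suc (suc (D + suc k)) ≡ D + suc (suc h + suc k)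
  reassoc = solve-∀
  double : ∀ D → 2 * D + 1 ≡ D + suc D
  double = solve-∀
  bound : D + suc (suc h + suc k) ≤ D + suc D
  bound = subst₂ _≤_ (reassoc D h k) (double D) (m≤o∸n⇒m+n≤o h (<⇒≤ n<2D+1) h≤)

numFix-broom-formula : ∀ {n D h} b k → 0 < h → D ≡ h + suc b → n ≡ suc (suc (D + suc k)) →
  numFix n (treeEdges n D h) ≡ fib D * fib (n ∸ D ∸ 1) + fib h * fib (D ∸ h) * fib (n ∸ D ∸ 2)
numFix-broom-formula {h = suc h′} b k _ refl refl = trans (numFix-broom h′ b k)
  (sym (cong₂ (λ x y → fib D * fib (x ∸ 1) + fib (suc h′) * fib y * fib (x ∸ 2))
              (2+m+n∸m≡2+n D (suc k)) (m+n∸m≡n (suc h′) (suc b))))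
  where
  D : ℕ
  D = suc h′ + suc b

lemma11 : (n D h : ℕ) →
    D < n ∸ 2 → 2 * (n ∸ 1) ≤ 3 * D →
    n ∸ D ∸ 1 ≤ h → h ≤ 2 * D + 1 ∸ n →
    numFix n (treeEdges n D h)
      ≡ fib D * fib (n ∸ D ∸ 1) + fib h * fib (D ∸ h) * fib (n ∸ D ∸ 2)
lemma11 zero          D h () _ _ _
lemma11 (suc zero)    D h () _ _ _
lemma11 (suc (suc n₀)) D h D<n₀ _ lower upper = numFix-broom-formula b k 0<h D≡h+1+b n≡
  where
  k : ℕ
  k = proj₁ (m≤n⇒∃[o]m+o≡n D<n₀)
  n≡ : suc (suc n₀) ≡ suc (suc (D + suc k))
  n≡ = cong (suc ∘ suc) (trans (sym (proj₂ (m≤n⇒∃[o]m+o≡n D<n₀))) (sym (+-suc D k)))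
  0<h : 0 < h
  0<h = ≤-trans (s≤s z≤n)
    (subst (λ x → x ∸ 1 ≤ h) (2+m+n∸m≡2+n D (suc k)) (subst (λ x → x ∸ D ∸ 1 ≤ h) n≡ lower))
  h<D : h < D
  h<D = branch-point-inside D h k 0<h (subst (λ x → h ≤ 2 * D + 1 ∸ x) n≡ upper)
  b : ℕ
  b = proj₁ (m≤n⇒∃[o]m+o≡n h<D)
  D≡h+1+b : D ≡ h + suc b
  D≡h+1+b = trans (sym (proj₂ (m≤n⇒∃[o]m+o≡n h<D))) (sym (+-suc h b))
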